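{- Let $r,a$ be positive integers and $d\in \{0,\dots,a-1\}$. Let $n\geq rd+r-d$, and let $t$ be the remainder when $n$ is divided by $rd+r-d$. Then \[\Sigma_{r,d}(a,n+1)-\Sigma_{r,d}(a,n)=\begin{cases} (a+1)n-(d+1)\Bigl\lfloor\frac{n}{rd+r-d}\Bigr\rfloor & \text{if }0\leq t\leq r-1,\\[6pt] (a+1)n - (d+1) \Bigl\lfloor \frac{n}{rd+r-d}\Bigr \rfloor - \Bigl \lfloor \frac{t-1}{r-1}\Bigr \rfloor & \text{if }r\leq t\leq rd+r-d-1. \end{cases}\] Furthermore, if $G\in T^e_{r,d}(a,n)$ has canonical partition $V_0\sqcup\dots\sqcup V_{r-1}$, then \[|V_0| =\begin{cases} \frac{n}{rd+r-d} & \text{if } t=0,\\[4pt] \Bigl\lfloor\frac{n}{rd+r-d}\Bigr\rfloor \text{ or } \Bigl\lceil\frac{n}{rd+r-d}\Bigr\rceil & \text{if } 1\leq t \leq r-1,\\[4pt] \Bigl\lceil\frac{n}{rd+r-d}\Bigr\rceil & \text{if } r\leq t\leq rd+r-d-1. \end{cases}\]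
   Context: A multigraph is a pair $G=(V,w)$ where $V$ is a finite set and $w:\binom{V}{2}\to\mathbb{Z}_{\geq 0}$; $e(G)=\sum_{xy\in\binom{V}{2}}w(xy)$. For positive integers $a,r$, $d\in\{0,\dots,a-1\}$ and $n$, $\mathcal{T}_{r,d}(a,n)$ is the set of multigraphs $G$ on $[n]=\{1,\dots,n\}$ whose vertex set can be partitioned into $r$ parts $V_0,\dots,V_{r-1}$ (a canonical partition of $G$) such that all pairs inside $V_0$ have multiplicity $a-d$, all pairs inside $V_i$ ($1\le i\le r-1$) have multiplicity $a$, and all other pairs have multiplicity $a+1$. $\Sigma_{r,d}(a,n)=\max\{e(G):G\in\mathcal{T}_{r,d}(a,n)\}$ and $T^e_{r,d}(a,n)$ is the set of $G\in\mathcal{T}_{r,d}(a,n)$ with $e(G)=\Sigma_{r,d}(a,n)$. -}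

module Defs where

open import Data.Nat using (ℕ; zero; suc; _+_; _*_; _∸_; _<_; _⊔_)
open import Data.Nat.DivMod using (_/_; _%_)
open import Data.Fin using (Fin; toℕ; _<?_)
open import Data.Fin.Properties using (_≟_)
open import Data.Nat.ListAction using (sum)
open import Data.List using (List; []; _∷_; map; filter; length; concatMap; foldr; allFin)
open import Data.Product using (_×_; _,_; ∃)
open import Relation.Nullary using (yes; no)
open import Relation.Binary.PropositionalEquality using (_≡_)
import Data.Nat as ℕ

-- A multigraph on [n] (vertices represented by Fin n).  The multiplicity of
-- the 2-set {i , j} with i < j is  w i j ; values w i j with i ≥ j are ignored.
Multigraph : ℕ → Set
Multigraph n = Fin n → Fin n → ℕ

pairs : (n : ℕ) → List (Fin n × Fin n)
pairs n = concatMap (λ i → map (λ j → (i , j)) (filter (λ j → i <? j) (allFin n))) (allFin n)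

e : {n : ℕ} → Multigraph n → ℕ
e {n} w = sum (map (λ p → w (Data.Product.proj₁ p) (Data.Product.proj₂ p)) (pairs n))

-- a partition of [n] into r labelled (possibly empty) parts V_0,…,V_{r-1}
Partition : ℕ → ℕ → Set
Partition n r = Fin n → Fin r

mult : {n r : ℕ} → (a d : ℕ) → Partition n r → Fin n → Fin n → ℕ
mult a d p i j with p i ≟ p j
... | no _ = suc a
... | yes _ with toℕ (p i) ℕ.≟ 0
...   | yes _ = a ∸ d
...   | no _ = a

Canonical : {n r : ℕ} → (a d : ℕ) → Multigraph n → Partition n r → Set
Canonical {n} a d w p = (i j : Fin n) → i Data.Fin.< j → w i j ≡ mult a d p i j

InT : (r d a n : ℕ) → Multigraph n → Set
InT r d a n w = ∃ λ (p : Partition n r) → Canonical a d w p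

consF : {n r : ℕ} → Fin r → (Fin n → Fin r) → Fin (suc n) → Fin r
consF c f Fin.zero = c
consF c f (Fin.suc i) = f i

allPartitions : (n r : ℕ) → List (Partition n r)
allPartitions zero r = (λ ()) ∷ []
allPartitions (suc n) r = concatMap (λ f → map (λ c → consF c f) (allFin r)) (allPartitions n r)

maxList : List ℕ → ℕ
maxList = foldr _⊔_ 0

-- Σ_{r,d}(a,n): maximum of e(G) over G ∈ 𝒯_{r,d}(a,n); every such G agrees
-- (on all 2-subsets) with the graph  mult a d p  of one of its canonical partitions p.
Sigma : (r d a n : ℕ) → ℕ
Sigma r d a n = maxList (map (λ p → e (mult {n} {r} a d p)) (allPartitions n r))

InTe : (r d a n : ℕ) → Multigraph n → Set
InTe r d a n w = InT r d a n w × e w ≡ Sigma r d a n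

size0 : {n r : ℕ} → Partition n r → ℕ
size0 {n} p = length (filter (λ i → toℕ (p i) ℕ.≟ 0) (allFin n))

-- total floor division (x div 0 = 0; only used with nonzero divisors)
_div_ : ℕ → ℕ → ℕ
x div zero = 0
x div suc y = x / suc y

_mod_ : ℕ → ℕ → ℕ
x mod zero = x
x mod suc y = x % suc y

cdiv : ℕ → ℕ → ℕ
cdiv x y = (x + y ∸ 1) div y

K : ℕ → ℕ → ℕ
K r d = r * d + r ∸ d

-- Relative to the complete multigraph of multiplicity a + 1, a graph of 𝒯_{r,d}(a,n) with class
-- sizes s₀, …, s_{r−1} misses (d+1)·C(s₀,2) + Σ_{i≥1} C(sᵢ,2) edges, so Σ_{r,d}(a,n) is (a+1)·C(n,2)
-- minus the minimum of this separable convex function over size vectors summing to n. Write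
-- n = qK + t with K = rd + r − d, and let L = (d+1)q if t < r and L = (d+1)q + ⌊(t−1)/(r−1)⌋ otherwise.
-- A line of slope L supports (d+1)·C(s,2) at q + 1 (and also at q when t < r) and every C(s,2) at L
-- and L + 1; size vectors built from these touching points exist for both n and n + 1, so they are
-- optimal and Σ(n+1) − Σ(n) = (a+1)n − L. An extremal graph must lie on every supporting line, which
-- determines |V₀| (for t = 0 the size q + 1 would leave too few vertices for the other classes).

module Submission where

open import Data.Bool using (Bool; true; false; if_then_else_)
open import Data.Empty using (⊥-elim)
open import Data.Fin using (Fin; toℕ; _<?_) renaming (zero to fz; suc to fs)
import Data.Fin as Fin
open import Data.Fin.Properties using (_≟_)
open import Data.List using (List; []; _∷_; map; filter; length; concatMap; tabulate; allFin; _++_)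
open import Data.List.Properties using (map-++; map-tabulate; map-∘; map-cong)
open import Data.Nat using (ℕ; zero; suc; _+_; _*_; _∸_; _≤_; _<_; _⊔_; z≤n; s≤s; z<s)
open import Data.Nat.Properties hiding (_≟_; _<?_)
import Data.Nat.Properties as ℕ
open import Data.Nat.DivMod using (_/_; _%_; m≡m%n+[m/n]*n; m%n<n; m<n⇒m/n≡0; m≥n⇒m/n>0; m*n/n≡m; +-distrib-/-∣ʳ)
open import Data.Nat.Divisibility using (divides-refl)
open import Data.Nat.ListAction using (sum)
open import Data.Nat.ListAction.Properties using (sum-++)
open import Data.Nat.Tactic.RingSolver using (solve-∀)
open import Data.Product using (_×_; _,_; ∃; proj₁; proj₂)
open import Data.Sum using (_⊎_; inj₁; inj₂; [_,_]′)
import Data.Sum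
open import Function using (_∘_; id)
open import Relation.Nullary using (yes; no; does; Dec)
open import Relation.Unary using (Pred; Decidable)
open import Relation.Binary.PropositionalEquality
open import Algebra.Properties.CommutativeMonoid.Sum +-0-commutativeMonoid
  using (sum-syntax; sum-cong-≗; sum-replicate-zero)

open import Defs

-- Supporting lines of s ↦ D·C(s,2)

choose2 : ℕ → ℕ
choose2 zero = 0
choose2 (suc x) = choose2 x + x

choose2-+ : ∀ x y → choose2 (x + y) ≡ choose2 x + x * y + choose2 y
choose2-+ zero y = refl
choose2-+ (suc x) y = begin
    choose2 (x + y) + (x + y)            ≡⟨ cong (_+ (x + y)) (choose2-+ x y) ⟩
    choose2 x + x * y + choose2 y + (x + y) ≡⟨ regroup (choose2 x) (choose2 y) x y ⟩
    choose2 x + x + (y + x * y) + choose2 y ∎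
  where
  open ≡-Reasoning
  regroup : ∀ A B x y → A + x * y + B + (x + y) ≡ A + x + (y + x * y) + B
  regroup = solve-∀

choose2*2+n≡n*n : ∀ x → choose2 x * 2 + x ≡ x * x
choose2*2+n≡n*n zero = refl
choose2*2+n≡n*n (suc x) = begin
    (choose2 x + x) * 2 + suc x        ≡⟨ regroup (choose2 x) x ⟩
    (choose2 x * 2 + x) + (x + x + 1) ≡⟨ cong (_+ (x + x + 1)) (choose2*2+n≡n*n x) ⟩
    x * x + (x + x + 1)                ≡⟨ square-suc x ⟩
    suc x * suc x                      ∎
  where
  open ≡-Reasoning
  regroup : ∀ B x → (B + x) * 2 + suc x ≡ (B * 2 + x) + (x + x + 1)
  regroup = solve-∀
  square-suc : ∀ x → x * x + (x + x + 1) ≡ suc x * suc x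
  square-suc = solve-∀

split-at-suc : ∀ q s → (∃ λ u → s ≡ suc q + u) ⊎ (∃ λ v → q ≡ s + v)
split-at-suc q zero = inj₂ (q , refl)
split-at-suc zero (suc s) = inj₁ (s , refl)
split-at-suc (suc q) (suc s) with split-at-suc q s
... | inj₁ (u , eq) = inj₁ (u , cong suc eq)
... | inj₂ (v , eq) = inj₂ (v , cong suc eq)

suc[m+n]∸m≡suc[n] : ∀ m n → suc (m + n) ∸ m ≡ suc n
suc[m+n]∸m≡suc[n] m n = trans (cong (_∸ m) (sym (+-suc m n))) (m+n∸m≡n m (suc n))

-- How far D·C(s,2) lies above the line of slope L = D q + x through (q+1, D·C(q+1,2));
-- when x + w = D this line supports s ↦ D·C(s,2), touching it at q+1 and, if x = 0, also at q.
slack : (D x w q s : ℕ) → ℕ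
slack D x w q s = D * choose2 (s ∸ suc q) + (s ∸ suc q) * w + D * choose2 (suc q ∸ s) + (suc q ∸ s) * x

supporting-line : ∀ D x w q L s → D ≡ x + w → L ≡ D * q + x →
  D * choose2 s + L * suc q ≡ L * s + D * choose2 (suc q) + slack D x w q s
supporting-line D x w q L s refl refl with split-at-suc q s
... | inj₁ (u , refl)
    rewrite m+n∸m≡n (suc q) u | m≤n⇒m∸n≡0 (m≤m+n (suc q) u) | choose2-+ (suc q) u =
  identity x w q u (choose2 (suc q)) (choose2 u)
  where
  identity : ∀ x w q u B1 Bu → (x + w) * (B1 + suc q * u + Bu) + ((x + w) * q + x) * suc q
     ≡ ((x + w) * q + x) * (suc q + u) + (x + w) * B1 + ((x + w) * Bu + u * w + (x + w) * 0 + 0 * x)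
  identity = solve-∀
... | inj₂ (v , refl)
    rewrite m≤n⇒m∸n≡0 (≤-trans (m≤m+n s v) (n≤1+n (s + v))) | suc[m+n]∸m≡suc[n] s v | choose2-+ s v =
  +-cancelʳ-≡ _ _ _ (trans (cong (λ z → X + (x + w) * z) (sym (choose2*2+n≡n*n v)))
                           (identity x w s v (choose2 s) (choose2 v)))
  where
  X = (x + w) * choose2 s + ((x + w) * (s + v) + x) * suc (s + v)
  identity : ∀ x w s v σ β → (x + w) * σ + ((x + w) * (s + v) + x) * suc (s + v) + (x + w) * (β * 2 + v)
     ≡ ((x + w) * (s + v) + x) * s + (x + w) * (σ + s * v + β + (s + v))
       + ((x + w) * 0 + 0 * w + (x + w) * (β + v) + suc v * x) + (x + w) * (v * v)
  identity = solve-∀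

slack-at-suc : ∀ D x w q → slack D x w q (suc q) ≡ 0
slack-at-suc D x w q rewrite n∸n≡0 q | *-zeroʳ D = refl

slack-at-self : ∀ D w q → slack D 0 w q q ≡ 0
slack-at-self D w q rewrite m≤n⇒m∸n≡0 (n≤1+n q) | m+n∸n≡m 1 q | *-zeroʳ D = refl

slack≡0-cases : ∀ D x w q s → 1 ≤ D → 1 ≤ w → slack D x w q s ≡ 0 → s ≡ suc q ⊎ (s ≡ q × x ≡ 0)
slack≡0-cases D x w q s 1≤D 1≤w eq with split-at-suc q s
... | inj₁ (u , refl) rewrite m+n∸m≡n (suc q) u | m≤n⇒m∸n≡0 (m≤m+n (suc q) u) =
  inj₁ (trans (cong (suc q +_) u≡0) (+-identityʳ _))
  where
  u≡0 : u ≡ 0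
  u≡0 = [ id , (λ w≡0 → ⊥-elim (<⇒≢ 1≤w (sym w≡0))) ]′
          (m*n≡0⇒m≡0∨n≡0 u (m+n≡0⇒n≡0 (D * choose2 u) (m+n≡0⇒m≡0 _ (m+n≡0⇒m≡0 _ eq))))
... | inj₂ (v , refl)
    rewrite m≤n⇒m∸n≡0 (≤-trans (m≤m+n s v) (n≤1+n (s + v))) | suc[m+n]∸m≡suc[n] s v =
  inj₂ (sym (trans (cong (s +_) v≡0) (+-identityʳ s)) , x≡0)
  where
  v≡0 : v ≡ 0
  v≡0 = m+n≡0⇒n≡0 (choose2 v)
          ([ (λ D≡0 → ⊥-elim (<⇒≢ 1≤D (sym D≡0))) , id ]′
            (m*n≡0⇒m≡0∨n≡0 D (m+n≡0⇒n≡0 (D * choose2 0 + 0 * w) (m+n≡0⇒m≡0 _ eq))))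
  x≡0 : x ≡ 0
  x≡0 = m+n≡0⇒m≡0 x (subst (λ z → suc z * x ≡ 0) v≡0 (m+n≡0⇒n≡0 (D * choose2 0 + 0 * w + D * choose2 (suc v)) eq))

iverson : Bool → ℕ
iverson true = 1
iverson false = 0

∑-zero : ∀ m (h : Fin m → ℕ) → (∀ k → h k ≡ 0) → ∑[ k < m ] h k ≡ 0
∑-zero m h h≡0 = trans (sum-cong-≗ h≡0) (sum-replicate-zero m)

∑≡0⇒≡0 : ∀ {m} (g : Fin m → ℕ) → ∑[ i < m ] g i ≡ 0 → ∀ i → g i ≡ 0
∑≡0⇒≡0 g eq fz = m+n≡0⇒m≡0 (g fz) eq
∑≡0⇒≡0 g eq (fs i) = ∑≡0⇒≡0 (g ∘ fs) (m+n≡0⇒n≡0 (g fz) eq) i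

*≤∑ : ∀ {m} L (g : Fin m → ℕ) → (∀ i → L ≤ g i) → m * L ≤ ∑[ i < m ] g i
*≤∑ {zero} L g L≤g = z≤n
*≤∑ {suc m} L g L≤g = +-mono-≤ (L≤g fz) (*≤∑ L (g ∘ fs) (L≤g ∘ fs))

∑-bump : ∀ {m} (h δ : Fin m → ℕ → ℕ) → (∀ k x → h k (suc x) ≡ h k x + δ k x) →
  ∀ (c : Fin m) (f : Fin m → ℕ) →
  ∑[ k < m ] h k (iverson (does (c ≟ k)) + f k) ≡ δ c (f c) + ∑[ k < m ] h k (f k)
∑-bump h δ h-suc fz f =
  trans (cong (_+ S) (h-suc fz (f fz))) (swap (h fz (f fz)) (δ fz (f fz)) S)
  where
  S = ∑[ k < _ ] h (fs k) (f (fs k))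
  swap : ∀ x y z → (x + y) + z ≡ y + (x + z)
  swap = solve-∀
∑-bump h δ h-suc (fs c) f =
  trans (cong (h fz (f fz) +_) (∑-bump (h ∘ fs) (δ ∘ fs) (h-suc ∘ fs) c (f ∘ fs)))
        (swap (h fz (f fz)) (δ (fs c) (f (fs c))) (∑[ k < _ ] h (fs k) (f (fs k))))
  where
  swap : ∀ x y z → x + (y + z) ≡ y + (x + z)
  swap = solve-∀

sum-map-filter-tabulate : ∀ {A : Set} {m} (f : Fin m → A) {ℓ} {P : Pred A ℓ} (P? : Decidable P) (h : A → ℕ) →
  sum (map h (filter P? (tabulate f))) ≡ ∑[ i < m ] (if does (P? (f i)) then h (f i) else 0)
sum-map-filter-tabulate {m = zero} f P? h = refl
sum-map-filter-tabulate {m = suc m} f P? h with does (P? (f fz))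
... | true = cong (h (f fz) +_) (sum-map-filter-tabulate (f ∘ fs) P? h)
... | false = sum-map-filter-tabulate (f ∘ fs) P? h

sum-map-concatMap-tabulate : ∀ {A B : Set} {m} (f : Fin m → A) (G : A → List B) (g : B → ℕ) →
  sum (map g (concatMap G (tabulate f))) ≡ ∑[ i < m ] sum (map g (G (f i)))
sum-map-concatMap-tabulate {m = zero} f G g = refl
sum-map-concatMap-tabulate {m = suc m} f G g = begin
    sum (map g (G (f fz) ++ concatMap G (tabulate (f ∘ fs))))
      ≡⟨ cong sum (map-++ g (G (f fz)) _) ⟩
    sum (map g (G (f fz)) ++ map g (concatMap G (tabulate (f ∘ fs))))
      ≡⟨ sum-++ (map g (G (f fz))) _ ⟩
    sum (map g (G (f fz))) + sum (map g (concatMap G (tabulate (f ∘ fs))))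
      ≡⟨ cong (sum (map g (G (f fz))) +_) (sum-map-concatMap-tabulate (f ∘ fs) G g) ⟩
    _ ∎
  where open ≡-Reasoning

length-filter-tabulate : ∀ {A : Set} {m} (f : Fin m → A) {ℓ} {P : Pred A ℓ} (P? : Decidable P) →
  length (filter P? (tabulate f)) ≡ ∑[ i < m ] iverson (does (P? (f i)))
length-filter-tabulate {m = zero} f P? = refl
length-filter-tabulate {m = suc m} f P? with does (P? (f fz))
... | true = cong suc (length-filter-tabulate (f ∘ fs) P?)
... | false = length-filter-tabulate (f ∘ fs) P?

pairSum : ∀ {n} → Multigraph n → ℕ
pairSum {n} w = ∑[ i < n ] ∑[ j < n ] (if does (i <? j) then w i j else 0)

e≡pairSum : ∀ {n} (w : Multigraph n) → e w ≡ pairSum w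
e≡pairSum {n} w = trans (sum-map-concatMap-tabulate id row-pairs weight) (sum-cong-≗ row)
  where
  weight = λ (p : Fin n × Fin n) → w (proj₁ p) (proj₂ p)
  row-pairs = λ i → map (λ j → (i , j)) (filter (λ j → i <? j) (allFin n))
  row : ∀ i → sum (map weight (row-pairs i)) ≡ _
  row i = trans (cong sum (sym (map-∘ (filter (λ j → i <? j) (allFin n)))))
                (sum-map-filter-tabulate id (λ j → i <? j) (w i))

e-cong : ∀ {n} (w w′ : Multigraph n) → (∀ i j → i Fin.< j → w i j ≡ w′ i j) → e w ≡ e w′
e-cong w w′ w≡w′ = trans (e≡pairSum w) (trans (sum-cong-≗ λ i → sum-cong-≗ λ j → entry i j (i <? j))
                                               (sym (e≡pairSum w′)))
  where
  entry : ∀ i j (i<?j : Dec (i Fin.< j)) →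
    (if does i<?j then w i j else 0) ≡ (if does i<?j then w′ i j else 0)
  entry i j (yes i<j) = w≡w′ i j i<j
  entry i j (no _) = refl

count : ∀ {n r} → (Fin n → Fin r) → Fin r → ℕ
count {zero} p c = 0
count {suc n} p c = iverson (does (p fz ≟ c)) + count (p ∘ fs) c

∑-count : ∀ {n r} (p : Fin n → Fin r) → ∑[ c < r ] count p c ≡ n
∑-count {zero} {r} p = sum-replicate-zero r
∑-count {suc n} p =
  trans (∑-bump (λ _ x → x) (λ _ _ → 1) (λ _ x → +-comm 1 x) (p fz) (count (p ∘ fs)))
        (cong suc (∑-count (p ∘ fs)))

size0≡count : ∀ {n r} (p : Partition n (suc r)) → size0 p ≡ count p fz
size0≡count {n} p = trans (length-filter-tabulate id (λ i → toℕ (p i) ℕ.≟ 0)) (sym (count-zero p))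
  where
  count-zero : ∀ {m} (g : Fin m → Fin (suc _)) → count g fz ≡ ∑[ i < m ] iverson (does (toℕ (g i) ℕ.≟ 0))
  count-zero {zero} g = refl
  count-zero {suc m} g = cong₂ _+_ (head (g fz)) (count-zero (g ∘ fs))
    where
    head : ∀ (x : Fin _) → iverson (does (x ≟ fz)) ≡ iverson (does (toℕ x ℕ.≟ 0))
    head fz = refl
    head (fs x) = refl

-- Edge count of a canonical graph

module _ (d : ℕ) where

  -- a + 1 minus the multiplicity of a pair inside class c
  classWeight : ∀ {r} (c : Fin r) → ℕ
  classWeight fz = suc d
  classWeight (fs _) = 1

  deficit : ∀ {r} → (Fin r → ℕ) → ℕ
  deficit {r} f = ∑[ k < r ] (classWeight k * choose2 (f k))

  deficit-count-suc : ∀ {n r} (p : Partition (suc n) r) →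
    deficit (count p) ≡ classWeight (p fz) * count (p ∘ fs) (p fz) + deficit (count (p ∘ fs))
  deficit-count-suc p =
    ∑-bump (λ k x → classWeight k * choose2 x) (λ k x → classWeight k * x)
           (λ k x → *-distribˡ-+ (classWeight k) (choose2 x) x) (p fz) (count (p ∘ fs))

module _ (a d : ℕ) where

  classMult : ∀ {r} → Fin r → Fin r → ℕ
  classMult c c′ with c ≟ c′
  ... | no _ = suc a
  ... | yes _ with toℕ c ℕ.≟ 0
  ...   | yes _ = a ∸ d
  ...   | no _ = a

  mult≡classMult : ∀ {n r} (p : Partition n r) i j → mult a d p i j ≡ classMult (p i) (p j)
  mult≡classMult p i j with p i ≟ p j
  ... | no _ = refl
  ... | yes _ with toℕ (p i) ℕ.≟ 0
  ...   | yes _ = refl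
  ...   | no _ = refl

  e-mult-suc : ∀ {n r} (p : Partition (suc n) r) →
    e (mult a d p) ≡ ∑[ j < n ] classMult (p fz) (p (fs j)) + e (mult a d (p ∘ fs))
  e-mult-suc {n} p = begin
      e (mult a d p)
        ≡⟨ e≡pairSum (mult a d p) ⟩
      ∑[ j < n ] mult a d p fz (fs j) + pairSum (λ i j → mult a d p (fs i) (fs j))
        ≡⟨ cong₂ _+_ (sum-cong-≗ (mult≡classMult p fz ∘ fs))
                     (sym (e≡pairSum (λ i j → mult a d p (fs i) (fs j)))) ⟩
      ∑[ j < n ] classMult (p fz) (p (fs j)) + e (λ i j → mult a d p (fs i) (fs j))
        ≡⟨ cong (∑[ j < n ] classMult (p fz) (p (fs j)) +_) (e-cong _ _ λ i j _ →
             trans (mult≡classMult p (fs i) (fs j)) (sym (mult≡classMult (p ∘ fs) i j))) ⟩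
      ∑[ j < n ] classMult (p fz) (p (fs j)) + e (mult a d (p ∘ fs)) ∎
    where open ≡-Reasoning

  module _ (d<a : d < a) where

    classMult+classWeight : ∀ {r} (c c′ : Fin r) →
      classMult c c′ + classWeight d c * iverson (does (c′ ≟ c)) ≡ suc a
    classMult+classWeight c c′ with c ≟ c′ | c′ ≟ c
    ... | yes refl | no c≢c = ⊥-elim (c≢c refl)
    ... | no c≢c | yes refl = ⊥-elim (c≢c refl)
    ... | no _ | no _ = trans (cong (suc a +_) (*-zeroʳ (classWeight d c))) (+-identityʳ (suc a))
    ... | yes refl | yes _ with c
    ...   | fz = trans (cong (a ∸ d +_) (*-identityʳ (suc d)))
                       (trans (+-suc (a ∸ d) d) (cong suc (m∸n+n≡m (<⇒≤ d<a))))
    ...   | fs _ = +-comm a 1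

    row-sum : ∀ {m r} (c : Fin r) (p : Fin m → Fin r) →
      ∑[ j < m ] classMult c (p j) + classWeight d c * count p c ≡ suc a * m
    row-sum {zero} c p = trans (*-zeroʳ (classWeight d c)) (sym (*-zeroʳ (suc a)))
    row-sum {suc m} c p = begin
        (classMult c (p fz) + S) + classWeight d c * (iverson (does (p fz ≟ c)) + C)
          ≡⟨ regroup (classMult c (p fz)) S (classWeight d c) (iverson (does (p fz ≟ c))) C ⟩
        (classMult c (p fz) + classWeight d c * iverson (does (p fz ≟ c))) + (S + classWeight d c * C)
          ≡⟨ cong₂ _+_ (classMult+classWeight c (p fz)) (row-sum c (p ∘ fs)) ⟩
        suc a + suc a * m
          ≡⟨ sym (*-suc (suc a) m) ⟩
        suc a * suc m ∎
      where
      open ≡-Reasoning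
      S = ∑[ j < m ] classMult c (p (fs j))
      C = count (p ∘ fs) c
      regroup : ∀ x S W i C → (x + S) + W * (i + C) ≡ (x + W * i) + (S + W * C)
      regroup = solve-∀

    e-mult+deficit : ∀ {n r} (p : Partition n r) → e (mult a d p) + deficit d (count p) ≡ suc a * choose2 n
    e-mult+deficit {zero} {r} p =
      trans (∑-zero r _ (λ k → *-zeroʳ (classWeight d k))) (sym (*-zeroʳ (suc a)))
    e-mult+deficit {suc n} p = begin
        e (mult a d p) + deficit d (count p)
          ≡⟨ cong₂ _+_ (e-mult-suc p) (deficit-count-suc d p) ⟩
        (R + e (mult a d p′)) + (W + deficit d (count p′))
          ≡⟨ interchange R (e (mult a d p′)) W (deficit d (count p′)) ⟩
        (R + W) + (e (mult a d p′) + deficit d (count p′))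
          ≡⟨ cong₂ _+_ (row-sum (p fz) p′) (e-mult+deficit p′) ⟩
        suc a * n + suc a * choose2 n
          ≡⟨ distrib (suc a) n (choose2 n) ⟩
        suc a * choose2 (suc n) ∎
      where
      open ≡-Reasoning
      p′ = p ∘ fs
      R = ∑[ j < n ] classMult (p fz) (p′ j)
      W = classWeight d (p fz) * count p′ (p fz)
      interchange : ∀ x y z u → (x + y) + (z + u) ≡ (x + z) + (y + u)
      interchange = solve-∀
      distrib : ∀ A n B → A * n + A * B ≡ A * (B + n)
      distrib = solve-∀

maxList-++ : ∀ xs ys → maxList (xs ++ ys) ≡ maxList xs ⊔ maxList ys
maxList-++ [] ys = refl
maxList-++ (x ∷ xs) ys = trans (cong (x ⊔_) (maxList-++ xs ys)) (sym (⊔-assoc x _ _))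

maxList-concatMap : ∀ {X Z : Set} (h : Z → ℕ) (G : X → List Z) xs →
  maxList (map h (concatMap G xs)) ≡ maxList (map (λ x → maxList (map h (G x))) xs)
maxList-concatMap h G [] = refl
maxList-concatMap h G (x ∷ xs) =
  trans (cong maxList (map-++ h (G x) (concatMap G xs)))
        (trans (maxList-++ (map h (G x)) _) (cong (maxList (map h (G x)) ⊔_) (maxList-concatMap h G xs)))

maxList-map+≤ : ∀ {X : Set} (h : X → ℕ) xs c Y → c ≤ Y → (∀ x → h x + c ≤ Y) → maxList (map h xs) + c ≤ Y
maxList-map+≤ h [] c Y c≤Y h+c≤Y = c≤Y
maxList-map+≤ h (x ∷ xs) c Y c≤Y h+c≤Y =
  subst (_≤ Y) (sym (+-distribʳ-⊔ c (h x) _)) (⊔-lub (h+c≤Y x) (maxList-map+≤ h xs c Y c≤Y h+c≤Y))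

≤-maxList-tabulate : ∀ {r} (g : Fin r → ℕ) c → g c ≤ maxList (tabulate g)
≤-maxList-tabulate g fz = m≤m⊔n _ _
≤-maxList-tabulate g (fs c) = ≤-trans (≤-maxList-tabulate (g ∘ fs) c) (m≤n⊔m (g fz) _)

≤-maxList-allFin : ∀ {r} (g : Fin r → ℕ) c → g c ≤ maxList (map g (allFin r))
≤-maxList-allFin g c = subst (g c ≤_) (cong maxList (sym (map-tabulate id g))) (≤-maxList-tabulate g c)

≤-maxList-allPartitions : ∀ n r (h : Partition n r → ℕ) →
  (∀ p p′ → (∀ i → p i ≡ p′ i) → h p ≡ h p′) →
  ∀ p → h p ≤ maxList (map h (allPartitions n r))
≤-maxList-allPartitions zero r h h-resp p = subst (_≤ h (λ ()) ⊔ 0) (h-resp (λ ()) p (λ ())) (m≤m⊔n (h (λ ())) 0)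
≤-maxList-allPartitions (suc n) r h h-resp p = begin
    h p
      ≡⟨ h-resp p (consF (p fz) (p ∘ fs)) (λ { fz → refl ; (fs i) → refl }) ⟩
    h (consF (p fz) (p ∘ fs))
      ≤⟨ ≤-maxList-allFin (λ c → h (consF c (p ∘ fs))) (p fz) ⟩
    h′ (p ∘ fs)
      ≤⟨ ≤-maxList-allPartitions n r h′ h′-resp (p ∘ fs) ⟩
    maxList (map h′ (allPartitions n r))
      ≡⟨ cong maxList (map-cong (λ f → cong maxList (map-∘ (allFin r))) (allPartitions n r)) ⟩
    maxList (map (λ f → maxList (map h (map (λ c → consF c f) (allFin r)))) (allPartitions n r))
      ≡⟨ sym (maxList-concatMap h _ (allPartitions n r)) ⟩
    maxList (map h (allPartitions (suc n) r)) ∎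
  where
  open ≤-Reasoning
  h′ : Partition n r → ℕ
  h′ f = maxList (map (λ c → h (consF c f)) (allFin r))
  h′-resp : ∀ f f′ → (∀ i → f i ≡ f′ i) → h′ f ≡ h′ f′
  h′-resp f f′ f≡f′ = cong maxList (map-cong (λ c → h-resp (consF c f) (consF c f′) (λ { fz → refl ; (fs i) → f≡f′ i }))
                                            (allFin r))

prepend : ∀ {M r} k → (Fin M → Fin r) → Fin r → Fin (k + M) → Fin r
prepend zero g z = g
prepend (suc k) g z fz = z
prepend (suc k) g z (fs i) = prepend k g z i

count-prepend : ∀ {M r} k (g : Fin M → Fin r) z c →
  count (prepend k g z) c ≡ k * iverson (does (z ≟ c)) + count g c
count-prepend zero g z c = refl
count-prepend (suc k) g z c =
  trans (cong (iverson (does (z ≟ c)) +_) (count-prepend k g z c)) (sym (+-assoc (iverson (does (z ≟ c))) _ _))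

count-fs-fz : ∀ {M r} (g : Fin M → Fin r) → count (fs ∘ g) fz ≡ 0
count-fs-fz {zero} g = refl
count-fs-fz {suc M} g = count-fs-fz (g ∘ fs)

count-fs-fs : ∀ {M r} (g : Fin M → Fin r) c → count (fs ∘ g) (fs c) ≡ count g c
count-fs-fs {zero} g c = refl
count-fs-fs {suc M} g c = cong (iverson (does (g fz ≟ c)) +_) (count-fs-fs (g ∘ fs) c)

partitionWithSizes : ∀ {m} (f : Fin m → ℕ) → Partition (∑[ k < m ] f k) m
partitionWithSizes {zero} f ()
partitionWithSizes {suc m} f = prepend (f fz) (fs ∘ partitionWithSizes (f ∘ fs)) fz

count-partitionWithSizes : ∀ {m} (f : Fin m → ℕ) c → count (partitionWithSizes f) c ≡ f c
count-partitionWithSizes {suc m} f fz =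
  trans (count-prepend (f fz) _ fz fz)
        (trans (cong₂ _+_ (*-identityʳ (f fz)) (count-fs-fz (partitionWithSizes (f ∘ fs)))) (+-identityʳ _))
count-partitionWithSizes {suc m} f (fs c) =
  trans (count-prepend (f fz) _ fz (fs c))
        (trans (cong₂ _+_ (*-zeroʳ (f fz)) (count-fs-fs (partitionWithSizes (f ∘ fs)) c))
               (count-partitionWithSizes (f ∘ fs) c))

e-mult-resp : ∀ a d {n r} (p p′ : Partition n r) → (∀ i → p i ≡ p′ i) → e (mult a d p) ≡ e (mult a d p′)
e-mult-resp a d p p′ p≡p′ = e-cong (mult a d p) (mult a d p′) λ i j _ →
  trans (mult≡classMult a d p i j)
        (trans (cong₂ (classMult a d) (p≡p′ i) (p≡p′ j)) (sym (mult≡classMult a d p′ i j)))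

Sigma-attained : ∀ r d a N c Y → (∀ p → e (mult {N} {r} a d p) + c ≤ Y) →
  (∃ λ p → e (mult {N} {r} a d p) + c ≡ Y) → Sigma r d a N + c ≡ Y
Sigma-attained r d a N c Y bound (p* , attained) = ≤-antisym
  (maxList-map+≤ h (allPartitions N r) c Y (subst (c ≤_) attained (m≤n+m c (h p*))) bound)
  (subst (_≤ Sigma r d a N + c) attained
         (+-monoˡ-≤ c (≤-maxList-allPartitions N r h (e-mult-resp a d) p*)))
  where
  h : Partition N r → ℕ
  h p = e (mult a d p)

∑-supporting-line : ∀ {m} D x w q L → D ≡ x + w → L ≡ D * q + x → (g : Fin m → ℕ) →
  ∑[ i < m ] (D * choose2 (g i)) + m * (L * suc q)
    ≡ L * ∑[ i < m ] g i + m * (D * choose2 (suc q)) + ∑[ i < m ] slack D x w q (g i)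
∑-supporting-line {zero} D x w q L _ _ g = sym (trans (+-identityʳ _) (trans (+-identityʳ _) (*-zeroʳ L)))
∑-supporting-line {suc m} D x w q L hD hL g = begin
    (P + ∑P) + (Y + m * Y)
      ≡⟨ interchange P ∑P Y (m * Y) ⟩
    (P + Y) + (∑P + m * Y)
      ≡⟨ cong₂ _+_ (supporting-line D x w q L (g fz) hD hL) (∑-supporting-line D x w q L hD hL (g ∘ fs)) ⟩
    (L * g fz + C + σ) + (L * ∑g + m * C + ∑σ)
      ≡⟨ collect L (g fz) C σ ∑g (m * C) ∑σ ⟩
    L * (g fz + ∑g) + (C + m * C) + (σ + ∑σ) ∎
  where
  open ≡-Reasoning
  P = D * choose2 (g fz)
  ∑P = ∑[ i < m ] (D * choose2 (g (fs i)))
  Y = L * suc q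
  C = D * choose2 (suc q)
  σ = slack D x w q (g fz)
  ∑g = ∑[ i < m ] g (fs i)
  ∑σ = ∑[ i < m ] slack D x w q (g (fs i))
  interchange : ∀ x s y z → (x + s) + (y + z) ≡ (x + y) + (s + z)
  interchange = solve-∀
  collect : ∀ L g₀ B σ G mB T → (L * g₀ + B + σ) + (L * G + mB + T) ≡ L * (g₀ + G) + (B + mB) + (σ + T)
  collect = solve-∀

-- Lagrangian relaxation, with multiplier L, of minimising the deficit under a prescribed sum of class sizes.
module Lagrange (a d : ℕ) (d<a : d < a) (r′ : ℕ) (x w q L : ℕ)
                (hD : suc d ≡ x + w) (hL : L ≡ suc d * q + x) where

  A B : ℕ
  A = L * suc q + r′ * (L * suc L)
  B = suc d * choose2 (suc q) + r′ * (1 * choose2 (suc L))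

  totalSlack : (Fin (suc r′) → ℕ) → ℕ
  totalSlack f = slack (suc d) x w q (f fz) + ∑[ i < r′ ] slack 1 0 1 L (f (fs i))

  totalSlack-cong : ∀ f g → (∀ k → f k ≡ g k) → totalSlack f ≡ totalSlack g
  totalSlack-cong f g f≡g =
    cong₂ _+_ (cong (slack (suc d) x w q) (f≡g fz)) (sum-cong-≗ (cong (slack 1 0 1 L) ∘ f≡g ∘ fs))

  deficit+A : ∀ f → deficit d f + A ≡ L * ∑[ k < suc r′ ] f k + B + totalSlack f
  deficit+A f = begin
      (P + ∑P) + (Y + r′ * Y′)
        ≡⟨ interchange P ∑P Y (r′ * Y′) ⟩
      (P + Y) + (∑P + r′ * Y′)
        ≡⟨ cong₂ _+_ (supporting-line (suc d) x w q L (f fz) hD hL)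
                     (∑-supporting-line 1 0 1 L L refl (sym (trans (+-identityʳ _) (*-identityˡ L))) (f ∘ fs)) ⟩
      (L * f fz + C + σ) + (L * ∑f + r′ * C′ + ∑σ)
        ≡⟨ collect L (f fz) C σ ∑f (r′ * C′) ∑σ ⟩
      L * (f fz + ∑f) + (C + r′ * C′) + (σ + ∑σ) ∎
    where
    open ≡-Reasoning
    P = suc d * choose2 (f fz)
    ∑P = ∑[ i < r′ ] (1 * choose2 (f (fs i)))
    Y = L * suc q
    Y′ = L * suc L
    C = suc d * choose2 (suc q)
    C′ = 1 * choose2 (suc L)
    σ = slack (suc d) x w q (f fz)
    ∑f = ∑[ i < r′ ] f (fs i)
    ∑σ = ∑[ i < r′ ] slack 1 0 1 L (f (fs i))
    interchange : ∀ x s y z → (x + s) + (y + z) ≡ (x + y) + (s + z)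
    interchange = solve-∀
    collect : ∀ L g₀ B σ G mB T → (L * g₀ + B + σ) + (L * G + mB + T) ≡ L * (g₀ + G) + (B + mB) + (σ + T)
    collect = solve-∀

  e-mult+totalSlack : ∀ {N} (p : Partition N (suc r′)) →
    e (mult a d p) + (L * N + B) + totalSlack (count p) ≡ suc a * choose2 N + A
  e-mult+totalSlack {N} p = begin
      E + (L * N + B) + totalSlack c
        ≡⟨ cong (λ z → E + (L * z + B) + totalSlack c) (sym (∑-count p)) ⟩
      E + (L * ∑[ k < suc r′ ] c k + B) + totalSlack c
        ≡⟨ +-assoc E _ _ ⟩
      E + (L * ∑[ k < suc r′ ] c k + B + totalSlack c)
        ≡⟨ cong (E +_) (sym (deficit+A c)) ⟩
      E + (deficit d c + A)
        ≡⟨ sym (+-assoc E _ _) ⟩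
      E + deficit d c + A
        ≡⟨ cong (_+ A) (e-mult+deficit a d d<a p) ⟩
      suc a * choose2 N + A ∎
    where
    open ≡-Reasoning
    E = e (mult a d p)
    c = count p

  Sigma+L*N+B : ∀ N (f : Fin (suc r′) → ℕ) → ∑[ k < suc r′ ] f k ≡ N → totalSlack f ≡ 0 →
    Sigma (suc r′) d a N + (L * N + B) ≡ suc a * choose2 N + A
  Sigma+L*N+B N f refl slack≡0 = Sigma-attained (suc r′) d a N (L * N + B) (suc a * choose2 N + A)
    (λ p → subst (e (mult a d p) + (L * N + B) ≤_) (e-mult+totalSlack p) (m≤m+n _ _))
    (p* , trans (sym (+-identityʳ _))
                (trans (cong (e (mult a d p*) + (L * N + B) +_) (sym slack*≡0)) (e-mult+totalSlack p*)))
    where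
    p* = partitionWithSizes f
    slack*≡0 : totalSlack (count p*) ≡ 0
    slack*≡0 = trans (totalSlack-cong _ _ (count-partitionWithSizes f)) slack≡0

  Sigma-increment : ∀ n (f₀ f₁ : Fin (suc r′) → ℕ) →
    ∑[ k < suc r′ ] f₀ k ≡ n → totalSlack f₀ ≡ 0 → ∑[ k < suc r′ ] f₁ k ≡ suc n → totalSlack f₁ ≡ 0 →
    Sigma (suc r′) d a (suc n) + L ≡ Sigma (suc r′) d a n + suc a * n
  Sigma-increment n f₀ f₁ ∑f₀ slack₀ ∑f₁ slack₁ = +-cancelʳ-≡ (L * n + B) _ _ (begin
      (S₁ + L) + (L * n + B)          ≡⟨ shift S₁ L n B ⟩
      S₁ + (L * suc n + B)            ≡⟨ Sigma+L*N+B (suc n) f₁ ∑f₁ slack₁ ⟩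
      suc a * (choose2 n + n) + A     ≡⟨ split (suc a) (choose2 n) n A ⟩
      (suc a * choose2 n + A) + suc a * n ≡⟨ cong (_+ suc a * n) (sym (Sigma+L*N+B n f₀ ∑f₀ slack₀)) ⟩
      (S₀ + (L * n + B)) + suc a * n  ≡⟨ swap S₀ (L * n + B) (suc a * n) ⟩
      (S₀ + suc a * n) + (L * n + B)  ∎)
    where
    open ≡-Reasoning
    S₀ = Sigma (suc r′) d a n
    S₁ = Sigma (suc r′) d a (suc n)
    shift : ∀ S L n B → (S + L) + (L * n + B) ≡ S + (L * suc n + B)
    shift = solve-∀
    split : ∀ A C n X → A * (C + n) + X ≡ (A * C + X) + A * n
    split = solve-∀
    swap : ∀ x y z → (x + y) + z ≡ (x + z) + y
    swap = solve-∀

  module Optimal {N} (p : Partition N (suc r′)) (optimal : e (mult a d p) ≡ Sigma (suc r′) d a N)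
                 (f : Fin (suc r′) → ℕ) (∑f : ∑[ k < suc r′ ] f k ≡ N) (slack≡0 : totalSlack f ≡ 0) where

    totalSlack≡0 : totalSlack (count p) ≡ 0
    totalSlack≡0 = +-cancelˡ-≡ (e (mult a d p) + (L * N + B)) _ _ (trans (e-mult+totalSlack p) (sym (begin
        e (mult a d p) + (L * N + B) + 0       ≡⟨ +-identityʳ _ ⟩
        e (mult a d p) + (L * N + B)           ≡⟨ cong (_+ (L * N + B)) optimal ⟩
        Sigma (suc r′) d a N + (L * N + B)     ≡⟨ Sigma+L*N+B N f ∑f slack≡0 ⟩
        suc a * choose2 N + A                  ∎)))
      where open ≡-Reasoning

    class0 : 1 ≤ w → count p fz ≡ suc q ⊎ (count p fz ≡ q × x ≡ 0)
    class0 1≤w = slack≡0-cases (suc d) x w q (count p fz) (s≤s z≤n) 1≤w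
      (m+n≡0⇒m≡0 (slack (suc d) x w q (count p fz)) totalSlack≡0)

    L≤class : ∀ i → L ≤ count p (fs i)
    L≤class i = [ (λ ≡suc → subst (L ≤_) (sym ≡suc) (n≤1+n L)) , (λ (≡L , _) → ≤-reflexive (sym ≡L)) ]′
      (slack≡0-cases 1 0 1 L (count p (fs i)) (s≤s z≤n) (s≤s z≤n)
        (∑≡0⇒≡0 (λ j → slack 1 0 1 L (count p (fs j)))
                (m+n≡0⇒n≡0 (slack (suc d) x w q (count p fz)) totalSlack≡0) i))

-- The two regimes

ones : ∀ {m} → ℕ → Fin m → ℕ
ones zero i = 0
ones (suc ρ) fz = 1
ones (suc ρ) (fs i) = ones ρ i

∑-L+ones : ∀ {m} L ρ → ρ ≤ m → ∑[ i < m ] (L + ones ρ i) ≡ m * L + ρ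
∑-L+ones {zero} L zero z≤n = refl
∑-L+ones {suc m} L zero z≤n = trans (cong (L + 0 +_) (∑-L+ones {m} L zero z≤n)) (regroup L m)
  where
  regroup : ∀ L m → (L + 0) + (m * L + 0) ≡ suc m * L + 0
  regroup = solve-∀
∑-L+ones {suc m} L (suc ρ) (s≤s ρ≤m) = trans (cong (L + 1 +_) (∑-L+ones {m} L ρ ρ≤m)) (regroup L m ρ)
  where
  regroup : ∀ L m ρ → (L + 1) + (m * L + ρ) ≡ suc m * L + suc ρ
  regroup = solve-∀

∑-slack-L+ones : ∀ {m} L ρ → ∑[ i < m ] slack 1 0 1 L (L + ones ρ i) ≡ 0
∑-slack-L+ones {m} L ρ = ∑-zero m _ (λ i → slack-L+ones (ones ρ i) (ones≤1 ρ i))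
  where
  ones≤1 : ∀ {m} ρ (i : Fin m) → ones ρ i ≡ 0 ⊎ ones ρ i ≡ 1
  ones≤1 zero i = inj₁ refl
  ones≤1 (suc ρ) fz = inj₂ refl
  ones≤1 (suc ρ) (fs i) = ones≤1 ρ i
  slack-L+ones : ∀ y → y ≡ 0 ⊎ y ≡ 1 → slack 1 0 1 L (L + y) ≡ 0
  slack-L+ones y (inj₁ refl) = subst (λ s → slack 1 0 1 L s ≡ 0) (sym (+-identityʳ L)) (slack-at-self 1 1 L)
  slack-L+ones y (inj₂ refl) = subst (λ s → slack 1 0 1 L s ≡ 0) (+-comm 1 L) (slack-at-suc 1 0 1 L)

sizes : ∀ {r′} → ℕ → ℕ → ℕ → Fin (suc r′) → ℕ
sizes L s₀ ρ fz = s₀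
sizes L s₀ ρ (fs i) = L + ones ρ i

Extremal : ∀ r d a {N} → Partition N r → Set
Extremal r d a {N} p = e (mult a d p) ≡ Sigma r d a N

regime-low : ∀ r′ a d n q t → d < a → n ≡ t + q * suc (r′ * suc d) → t ≤ r′ →
  Sigma (suc r′) d a (suc n) + suc d * q ≡ Sigma (suc r′) d a n + suc a * n
  × (∀ (p : Partition n (suc r′)) → Extremal (suc r′) d a p →
       (count p fz ≡ q ⊎ count p fz ≡ suc q) × (t ≡ 0 → count p fz ≡ q))
regime-low r′ a d n q t d<a n≡ t≤r′ =
    Sigma-increment n f₀ f₁ ∑f₀ slack₀ ∑f₁ slack₁
  , λ p extremal → let open Optimal p extremal f₀ ∑f₀ slack₀ in
      [ inj₂ , inj₁ ∘ proj₁ ]′ (class0 (s≤s z≤n))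
    , λ t≡0 → [ (λ ≡suc → ⊥-elim (<-irrefl refl (too-big p (L≤class) ≡suc t≡0))) , proj₁ ]′ (class0 (s≤s z≤n))
  where
  L = suc d * q
  open Lagrange a d d<a r′ 0 (suc d) q L refl (sym (+-identityʳ L))
  f₀ f₁ : Fin (suc r′) → ℕ
  f₀ = sizes L q t
  f₁ = sizes L (suc q) t
  ∑f₀ : ∑[ k < suc r′ ] f₀ k ≡ n
  ∑f₀ = trans (cong (q +_) (∑-L+ones L t t≤r′)) (trans (regroup q r′ d t) (sym n≡))
    where
    regroup : ∀ q r′ d t → q + (r′ * (suc d * q) + t) ≡ t + q * suc (r′ * suc d)
    regroup = solve-∀
  ∑f₁ : ∑[ k < suc r′ ] f₁ k ≡ suc n
  ∑f₁ = cong suc ∑f₀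
  slack₀ : totalSlack f₀ ≡ 0
  slack₀ = cong₂ _+_ (slack-at-self (suc d) (suc d) q) (∑-slack-L+ones {r′} L t)
  slack₁ : totalSlack f₁ ≡ 0
  slack₁ = cong₂ _+_ (slack-at-suc (suc d) 0 (suc d) q) (∑-slack-L+ones {r′} L t)
  -- If n = qK, the other r − 1 classes have at least L = (d+1)q vertices each, leaving only q for class 0.
  too-big : ∀ (p : Partition n (suc r′)) → (∀ i → L ≤ count p (fs i)) → count p fz ≡ suc q → t ≡ 0 →
    suc q + r′ * L ≤ q + r′ * L
  too-big p L≤class ≡suc refl = begin
      suc q + r′ * L                          ≤⟨ +-monoʳ-≤ (suc q) (*≤∑ L (count p ∘ fs) L≤class) ⟩
      suc q + ∑[ i < r′ ] count p (fs i)      ≡⟨ cong (_+ ∑[ i < r′ ] count p (fs i)) (sym ≡suc) ⟩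
      ∑[ k < suc r′ ] count p k               ≡⟨ ∑-count p ⟩
      n                                       ≡⟨ n≡ ⟩
      q * suc (r′ * suc d)                    ≡⟨ regroup q r′ d ⟩
      q + r′ * L                              ∎
    where
    open ≤-Reasoning
    regroup : ∀ q r′ d → q * suc (r′ * suc d) ≡ q + r′ * (suc d * q)
    regroup = solve-∀

-- Here the excess x = ⌊(t−1)/(r−1)⌋ satisfies 1 ≤ x ≤ d, so the line of slope L = (d+1)q + x
-- touches (d+1)·C(s,2) only at s = q+1.
regime-high : ∀ r′ a d n q t → d < a → n ≡ t + q * suc (r′ * suc d) → t < suc (r′ * suc d) → suc r′ ≤ t →
  Sigma (suc r′) d a (suc n) + (suc d * q + (t ∸ 1) div r′) ≡ Sigma (suc r′) d a n + suc a * n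
  × (∀ (p : Partition n (suc r′)) → Extremal (suc r′) d a p → count p fz ≡ suc q)
regime-high zero a d n q t d<a n≡ t<K r≤t = ⊥-elim (<⇒≱ t<K r≤t)
regime-high r′@(suc R) a d n q (suc t₁) d<a n≡ (s≤s t₁<M) (s≤s r′≤t₁) =
    Sigma-increment n f₀ f₁ ∑f₀ slack₀ ∑f₁ slack₁
  , λ p extremal → let open Optimal p extremal f₀ ∑f₀ slack₀ in
      [ id , (λ (_ , x≡0) → ⊥-elim (<⇒≢ 1≤x (sym x≡0))) ]′ (class0 1≤w)
  where
  x = t₁ / r′
  ρ = t₁ % r′
  t₁≡ : t₁ ≡ ρ + x * r′
  t₁≡ = m≡m%n+[m/n]*n t₁ r′
  ρ<r′ : ρ < r′
  ρ<r′ = m%n<n t₁ r′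
  x<sd : x < suc d
  x<sd = *-cancelʳ-< r′ x (suc d) (begin-strict
      x * r′       ≤⟨ m≤n+m (x * r′) ρ ⟩
      ρ + x * r′   ≡⟨ sym t₁≡ ⟩
      t₁           <⟨ t₁<M ⟩
      r′ * suc d   ≡⟨ *-comm r′ (suc d) ⟩
      suc d * r′   ∎)
    where open ≤-Reasoning
  1≤x : 1 ≤ x
  1≤x = m≥n⇒m/n>0 r′≤t₁
  w = suc d ∸ x
  1≤w : 1 ≤ w
  1≤w = m<n⇒0<n∸m x<sd
  L = suc d * q + x
  open Lagrange a d d<a r′ x w q L (sym (m+[n∸m]≡n (<⇒≤ x<sd))) refl
  f₀ f₁ : Fin (suc r′) → ℕ
  f₀ = sizes L (suc q) ρ
  f₁ = sizes L (suc q) (suc ρ)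
  n≡′ : n ≡ suc (ρ + x * r′) + q * suc (r′ * suc d)
  n≡′ = trans n≡ (cong (λ z → suc z + q * suc (r′ * suc d)) t₁≡)
  ∑f₀ : ∑[ k < suc r′ ] f₀ k ≡ n
  ∑f₀ = trans (cong (suc q +_) (∑-L+ones L ρ (<⇒≤ ρ<r′))) (trans (regroup q R d ρ x) (sym n≡′))
    where
    regroup : ∀ q R d ρ x → suc q + (suc R * (suc d * q + x) + ρ) ≡ suc (ρ + x * suc R) + q * suc (suc R * suc d)
    regroup = solve-∀
  ∑f₁ : ∑[ k < suc r′ ] f₁ k ≡ suc n
  ∑f₁ = trans (cong (suc q +_) (∑-L+ones L (suc ρ) ρ<r′)) (trans (regroup q R d ρ x) (cong suc (sym n≡′)))
    where
    regroup : ∀ q R d ρ x → suc q + (suc R * (suc d * q + x) + suc ρ) ≡ suc (suc (ρ + x * suc R) + q * suc (suc R * suc d))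
    regroup = solve-∀
  slack₀ : totalSlack f₀ ≡ 0
  slack₀ = cong₂ _+_ (slack-at-suc (suc d) x w q) (∑-slack-L+ones {r′} L ρ)
  slack₁ : totalSlack f₁ ≡ 0
  slack₁ = cong₂ _+_ (slack-at-suc (suc d) x w q) (∑-slack-L+ones {r′} L (suc ρ))

[m+kn]/n≡k : ∀ m k n → m < suc n → (m + k * suc n) / suc n ≡ k
[m+kn]/n≡k m k n m<n = trans (+-distrib-/-∣ʳ m (divides-refl k)) (cong₂ _+_ (m<n⇒m/n≡0 m<n) (m*n/n≡m k (suc n)))

cdiv≡suc : ∀ n k q t → n ≡ t + q * suc k → 1 ≤ t → t < suc k → cdiv n (suc k) ≡ suc q
cdiv≡suc n k q (suc t′) refl (s≤s z≤n) (s≤s t′<k) =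
  trans (cong (_/ suc k) (regroup t′ q k)) ([m+kn]/n≡k t′ (suc q) k (m<n⇒m<1+n t′<k))
  where
  regroup : ∀ t′ q k → t′ + q * suc k + suc k ≡ t′ + suc q * suc k
  regroup = solve-∀

extremal : ∀ {r d a n} (G : Multigraph n) (p : Partition n r) → InTe r d a n G → Canonical a d G p →
  Extremal r d a p
extremal {r} {d} {a} G p (_ , e≡Sigma) canonical = trans (sym (e-cong G (mult a d p) canonical)) e≡Sigma

open import Data.Integer using (+_; _-_)
import Data.Integer as ℤ
import Data.Integer.Properties as ℤ-Properties
import Data.Integer.Tactic.RingSolver as ℤ-Solver

+-minus-+ : ∀ S₁ S₀ L M → S₁ + L ≡ S₀ + M → + S₁ - + S₀ ≡ + M - + L
+-minus-+ S₁ S₀ L M eq = begin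
    + S₁ - + S₀                  ≡⟨ add-subtract (+ S₁) (+ L) (+ S₀) ⟩
    + (S₁ + L) - + L - + S₀      ≡⟨ cong (λ z → + z - + L - + S₀) eq ⟩
    + (S₀ + M) - + L - + S₀      ≡⟨ cancel (+ S₀) (+ M) (+ L) ⟩
    + M - + L                    ∎
  where
  open ≡-Reasoning
  add-subtract : ∀ x l y → x - y ≡ (x ℤ.+ l) - l - y
  add-subtract = ℤ-Solver.solve-∀
  cancel : ∀ y m l → (y ℤ.+ m) - l - y ≡ m - l
  cancel = ℤ-Solver.solve-∀

Conclusion : (r a d n q t k : ℕ) → Set
Conclusion r a d n q t k =
    (t < r →
      (+ Sigma r d a (suc n)) - (+ Sigma r d a n)
        ≡ (+ ((a + 1) * n)) - (+ ((d + 1) * q)))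
    × (r ≤ t →
      (+ Sigma r d a (suc n)) - (+ Sigma r d a n)
        ≡ ((+ ((a + 1) * n)) - (+ ((d + 1) * q)))
            - (+ ((t ∸ 1) div (r ∸ 1))))
    × ((G : Multigraph n) → (p : Partition n r) → InTe r d a n G → Canonical a d G p →
      (t ≡ 0 → size0 p ≡ q)
      × (1 ≤ t → t < r → (size0 p ≡ q) ⊎ (size0 p ≡ cdiv n k))
      × (r ≤ t → size0 p ≡ cdiv n k))

increment-in-ℤ : ∀ r a d n q x → Sigma r d a (suc n) + (suc d * q + x) ≡ Sigma r d a n + suc a * n →
  + Sigma r d a (suc n) - + Sigma r d a n ≡ (+ ((a + 1) * n) - + ((d + 1) * q)) - + x
increment-in-ℤ r a d n q x eq = begin
    + Sigma r d a (suc n) - + Sigma r d a n     ≡⟨ +-minus-+ (Sigma r d a (suc n)) (Sigma r d a n) (suc d * q + x) (suc a * n) eq ⟩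
    + (suc a * n) - + (suc d * q + x)           ≡⟨ split (+ (suc a * n)) (+ (suc d * q)) (+ x) ⟩
    (+ (suc a * n) - + (suc d * q)) - + x       ≡⟨ cong₂ (λ u v → (+ (u * n) - + (v * q)) - + x) (+-comm 1 a) (+-comm 1 d) ⟩
    (+ ((a + 1) * n) - + ((d + 1) * q)) - + x   ∎
  where
  open ≡-Reasoning
  split : ∀ m y x → m - (y ℤ.+ x) ≡ (m - y) - x
  split = ℤ-Solver.solve-∀

conclusion-low : ∀ r′ a d n q t → d < a → n ≡ t + q * suc (r′ * suc d) → t < suc r′ →
  Conclusion (suc r′) a d n q t (suc (r′ * suc d))
conclusion-low r′ a d n q t d<a n≡ t<r =
    (λ _ → trans (increment-in-ℤ (suc r′) a d n q 0 (subst (λ L → Sigma (suc r′) d a (suc n) + L ≡ Sigma (suc r′) d a n + suc a * n)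
                                                           (sym (+-identityʳ _)) increment))
                 (ℤ-Properties.+-identityʳ _))
  , (λ r≤t → ⊥-elim (<⇒≱ t<r r≤t))
  , λ G p inTe canonical → let sizes0 = class0 p (extremal G p inTe canonical) in
        (λ t≡0 → trans (size0≡count p) (proj₂ sizes0 t≡0))
      , (λ 1≤t _ → Data.Sum.map (trans (size0≡count p))
                                (λ ≡suc → trans (size0≡count p) (trans ≡suc (sym (cdiv≡suc n _ q t n≡ 1≤t t<K))))
                                (proj₁ sizes0))
      , (λ r≤t → ⊥-elim (<⇒≱ t<r r≤t))
  where
  t<K : t < suc (r′ * suc d)
  t<K = ≤-trans t<r (s≤s (m≤m*n r′ (suc d)))
  increment = proj₁ (regime-low r′ a d n q t d<a n≡ (≤-pred t<r))
  class0 = proj₂ (regime-low r′ a d n q t d<a n≡ (≤-pred t<r))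

conclusion-high : ∀ r′ a d n q t → d < a → n ≡ t + q * suc (r′ * suc d) → t < suc (r′ * suc d) → suc r′ ≤ t →
  Conclusion (suc r′) a d n q t (suc (r′ * suc d))
conclusion-high r′ a d n q t d<a n≡ t<K r≤t =
    (λ t<r → ⊥-elim (<⇒≱ t<r r≤t))
  , (λ _ → increment-in-ℤ (suc r′) a d n q ((t ∸ 1) div r′) increment)
  , λ G p inTe canonical →
        (λ t≡0 → ⊥-elim (<⇒≢ (<-≤-trans z<s r≤t) (sym t≡0)))
      , (λ _ t<r → ⊥-elim (<⇒≱ t<r r≤t))
      , (λ _ → trans (size0≡count p) (trans (class0 p (extremal G p inTe canonical))
                                            (sym (cdiv≡suc n _ q t n≡ (<-≤-trans z<s r≤t) t<K))))
  where
  increment = proj₁ (regime-high r′ a d n q t d<a n≡ t<K r≤t)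
  class0 = proj₂ (regime-high r′ a d n q t d<a n≡ t<K r≤t)

K-suc : ∀ r′ d → K (suc r′) d ≡ suc (r′ * suc d)
K-suc r′ d = trans (cong (_∸ d) (regroup r′ d)) (m+n∸m≡n d (suc (r′ * suc d)))
  where
  regroup : ∀ r′ d → suc r′ * d + suc r′ ≡ d + suc (r′ * suc d)
  regroup = solve-∀

conclusion : ∀ r′ a d n → d < a → let k = suc (r′ * suc d) in Conclusion (suc r′) a d n (n / k) (n % k) k
conclusion r′ a d n d<a with n % suc (r′ * suc d) ℕ.<? suc r′
... | yes t<r = conclusion-low r′ a d n _ _ d<a (m≡m%n+[m/n]*n n _) t<r
... | no t≮r = conclusion-high r′ a d n _ _ d<a (m≡m%n+[m/n]*n n _) (m%n<n n _) (≮⇒≥ t≮r)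

proposition5p3 : (r a d n : ℕ) → 1 ≤ r → 1 ≤ a → d < a → K r d ≤ n →
    ((n mod K r d) < r →
      (+ Sigma r d a (suc n)) - (+ Sigma r d a n)
        ≡ (+ ((a + 1) * n)) - (+ ((d + 1) * (n div K r d))))
    × (r ≤ (n mod K r d) →
      (+ Sigma r d a (suc n)) - (+ Sigma r d a n)
        ≡ ((+ ((a + 1) * n)) - (+ ((d + 1) * (n div K r d))))
            - (+ (((n mod K r d) ∸ 1) div (r ∸ 1))))
    × ((G : Multigraph n) → (p : Partition n r) → InTe r d a n G → Canonical a d G p →
      ((n mod K r d) ≡ 0 → size0 p ≡ n div K r d)
      × (1 ≤ (n mod K r d) → (n mod K r d) < r →
          (size0 p ≡ n div K r d) ⊎ (size0 p ≡ cdiv n (K r d)))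
      × (r ≤ (n mod K r d) → size0 p ≡ cdiv n (K r d)))
proposition5p3 zero a d n () _ _ _
proposition5p3 (suc r′) a d n _ _ d<a _ =
  subst (λ k → Conclusion (suc r′) a d n (n div k) (n mod k) k) (sym (K-suc r′ d)) (conclusion r′ a d n d<a)
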